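{- Let $X = K_{n_1,\ldots,n_m}$ and let $P$ be a regular partition of $V(X)$. Then the group $\mathrm{aut}(P)$ is isomorphic to the automorphism group $\mathrm{aut}(\tau(P))$ of the hypergraph $\tau(P)$.
   Context: $K_{n_1,\ldots,n_m}$ is the complete multipartite graph with maximal independent sets (parts) $X_1,\dots,X_m$, $|X_i|=n_i$; $\mathrm{aut}(X)$ is its graph automorphism group. A partition $P=\{P_1,\dots,P_t\}$ of $V(X)$ is regular if $|X_i\cap P_{i'}|\le1$ for all $i,i'$. For $\gamma\in\mathrm{aut}(X)$, $\gamma(P)=\{\gamma(P_1),\dots,\gamma(P_t)\}$, and $\mathrm{aut}(P)$ is the subgroup of $\gamma\in\mathrm{aut}(X)$ with $\gamma(P)=P$. The hypergraph $\tau(P)$ has vertex set $\{P_1,\dots,P_t\}$, edge set $\{X_1,\dots,X_m\}$, and $P_{i'}$ incident to $X_i$ iff $|X_i\cap P_{i'}|=1$. A hypergraph is a triple (vertex set, edge set, incidence relation $\subseteq V\times E$); an automorphism of a hypergraph is a pair of permutations of the vertices and of the edges such that $(v,e)$ is incident iff $(\sigma(v),\sigma(e))$ is incident. -}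

module Defs where

open import Level using (0ℓ)
open import Data.Nat using (ℕ; _≤_)
open import Data.Fin using (Fin)
open import Data.Product using (Σ; _×_; _,_; proj₁; proj₂; ∃)
open import Relation.Nullary using (¬_)
open import Relation.Binary.PropositionalEquality using (_≡_)
open import Function.Bundles using (_↔_; Inverse)

open Inverse

-- Vertex set of the complete multipartite graph K_{n_1,...,n_m}:
-- vertex (i , a) is the a-th vertex of the part X_i.
V : (m : ℕ) → (Fin m → ℕ) → Set
V m n = Σ (Fin m) (λ i → Fin (n i))

Adj : ∀ {m} {n : Fin m → ℕ} → V m n → V m n → Set
Adj u v = ¬ (proj₁ u ≡ proj₁ v)

IsGraphAut : ∀ {m} {n : Fin m → ℕ} → (V m n ↔ V m n) → Set
IsGraphAut {m} {n} γ = ∀ (u v : V m n) →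
  (Adj u v → Adj (to γ u) (to γ v)) × (Adj (to γ u) (to γ v) → Adj u v)

-- A partition P = {P_1,...,P_t} of V(X) is given by its block-labelling map p : V(X) → Fin t,
-- P_j = p⁻¹(j); blocks are nonempty, i.e. p is surjective.
IsPartition : ∀ {m} {n : Fin m → ℕ} {t : ℕ} → (V m n → Fin t) → Set
IsPartition {m} {n} {t} p = ∀ (j : Fin t) → ∃ λ (v : V m n) → p v ≡ j

-- Regularity: |X_i ∩ P_j| ≤ 1 for all i, j.
IsRegular : ∀ {m} {n : Fin m → ℕ} {t : ℕ} → (V m n → Fin t) → Set
IsRegular {m} {n} {t} p = ∀ (i : Fin m) (j : Fin t) (a b : Fin (n i)) →
  p (i , a) ≡ j → p (i , b) ≡ j → a ≡ b

-- γ(P) = P: γ maps every block P_j onto a block P_{π j}, π a permutation of the blocks.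
PreservesPartition : ∀ {m} {n : Fin m → ℕ} {t : ℕ} → (V m n → Fin t) → (V m n ↔ V m n) → Set
PreservesPartition {m} {n} {t} p γ =
  Σ (Fin t ↔ Fin t) λ π → ∀ (v : V m n) → p (to γ v) ≡ to π (p v)

AutP : ∀ {m} (n : Fin m → ℕ) {t : ℕ} → (V m n → Fin t) → Set
AutP {m} n p = Σ (V m n ↔ V m n) λ γ → IsGraphAut γ × PreservesPartition p γ

perm : ∀ {m} {n : Fin m → ℕ} {t : ℕ} {p : V m n → Fin t} → AutP n p → V m n → V m n
perm α = to (proj₁ α)

record Hypergraph : Set₁ where
  field
    Vert : Set
    Edge : Set
    Inc  : Vert → Edge → Set

open Hypergraph

HypAut : Hypergraph → Set
HypAut H = Σ (Vert H ↔ Vert H) λ σ → Σ (Edge H ↔ Edge H) λ ρ →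
  ∀ (v : Vert H) (e : Edge H) →
    (Inc H v e → Inc H (to σ v) (to ρ e)) × (Inc H (to σ v) (to ρ e) → Inc H v e)

vmap : ∀ {H} → HypAut H → Vert H → Vert H
vmap h = to (proj₁ h)

emap : ∀ {H} → HypAut H → Edge H → Edge H
emap h = to (proj₁ (proj₂ h))

-- The hypergraph τ(P): vertices the blocks P_j, edges the parts X_i,
-- P_j incident to X_i iff |X_i ∩ P_j| = 1 (exactly one a with (i , a) ∈ P_j).
τ : ∀ {m} (n : Fin m → ℕ) {t : ℕ} → (V m n → Fin t) → Hypergraph
τ {m} n {t} p = record
  { Vert = Fin t
  ; Edge = Fin m
  ; Inc  = λ j i → Σ (Fin (n i)) λ a → p (i , a) ≡ j × (∀ (b : Fin (n i)) → p (i , b) ≡ j → b ≡ a)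
  }

-- Group isomorphism aut(P) ≅ aut(τ(P)), both groups under composition of maps,
-- with equality of elements = equality of the underlying maps.
_≈P_ : ∀ {m} {n : Fin m → ℕ} {t : ℕ} {p : V m n → Fin t} → AutP n p → AutP n p → Set
_≈P_ {m} {n} α β = ∀ (v : V m n) → perm α v ≡ perm β v

_≈H_ : ∀ {H} → HypAut H → HypAut H → Set
_≈H_ {H} g h = (∀ (v : Vert H) → vmap g v ≡ vmap h v) × (∀ (e : Edge H) → emap g e ≡ emap h e)

record IsGroupIso {m} {n : Fin m → ℕ} {t : ℕ} (p : V m n → Fin t)
                  (Φ : AutP n p → HypAut (τ n p)) : Set where
  field
    cong     : ∀ α β → α ≈P β → Φ α ≈H Φ β
    homo     : ∀ α β γ → (∀ (v : V m n) → perm γ v ≡ perm α (perm β v)) →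
               (∀ (j : Fin t) → vmap (Φ γ) j ≡ vmap (Φ α) (vmap (Φ β) j)) ×
               (∀ (i : Fin m) → emap (Φ γ) i ≡ emap (Φ α) (emap (Φ β) i))
    injective  : ∀ α β → Φ α ≈H Φ β → α ≈P β
    surjective : ∀ (h : HypAut (τ n p)) → ∃ λ α → Φ α ≈H h

module Submission where

-- An automorphism γ of X maps non-adjacent vertices to non-adjacent ones, i.e.
-- it maps parts onto parts; since every part is nonempty this yields a
-- permutation ρ_γ of the parts X_i (the edges of τ(P)).  If moreover γ ∈ aut(P)
-- it permutes the blocks P_j (the vertices of τ(P)) by some π_γ, and the pair
-- Φ(γ) = (π_γ , ρ_γ) preserves incidence.  Regularity says that a vertex of X
-- is determined by its part and its block, which gives injectivity of Φ and,
-- conversely, lets every hypergraph automorphism (σ , ρ) be lifted to the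
-- vertex map (i , a) ↦ the unique vertex of X_{ρ i} lying in P_{σ(p(i , a))};
-- this lift lies in aut(P), which is surjectivity.  Surjectivity of the block
-- labelling p shows that π_γ is determined by γ, giving well-definedness and
-- the homomorphism property.

open import Defs
open import Data.Nat using (ℕ; _≤_; s≤s)
open import Data.Fin using (Fin; zero)
open import Data.Fin.Properties using (_≟_)
open import Data.Product using (Σ; _×_; _,_; proj₁; proj₂; ∃)
open import Relation.Nullary using (¬_)
open import Relation.Nullary.Decidable using (decidable-stable)
open import Relation.Binary.PropositionalEquality
open import Function using (id)
open import Function.Bundles using (_↔_; Inverse; Injection; mk↔ₛ′)
open import Function.Properties.Inverse using (↔-sym; Inverse⇒Injection)
open Inverse
open Hypergraph
open ≡-Reasoning

↔-injective : ∀ {A : Set} (f : A ↔ A) {x y : A} → to f x ≡ to f y → x ≡ y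
↔-injective f = Injection.injective (Inverse⇒Injection f)

surjection-cancel : ∀ {A B C : Set} (q : A → B) → (∀ b → ∃ λ a → q a ≡ b) →
                    (f g : B → C) → (∀ a → f (q a) ≡ g (q a)) → ∀ b → f b ≡ g b
surjection-cancel q q-onto f g agree b with q-onto b
... | a , refl = agree a

PreservesInc : (H : Hypergraph) → (Vert H → Vert H) → (Edge H → Edge H) → Set
PreservesInc H s r = ∀ v e → Inc H v e → Inc H (s v) (r e)

mkHypAut : ∀ {H} (σ : Vert H ↔ Vert H) (ρ : Edge H ↔ Edge H) →
           PreservesInc H (to σ) (to ρ) → PreservesInc H (from σ) (from ρ) → HypAut H
mkHypAut {H} σ ρ fwd bwd = σ , ρ , λ v e → fwd v e , back v e
  where
  back : ∀ v e → Inc H (to σ v) (to ρ e) → Inc H v e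
  back v e inc = subst₂ (Inc H) (strictlyInverseʳ σ v) (strictlyInverseʳ ρ e)
                        (bwd (to σ v) (to ρ e) inc)

hypAut⁻¹ : ∀ {H} → HypAut H → HypAut H
hypAut⁻¹ {H} (σ , ρ , inc) = mkHypAut (↔-sym σ) (↔-sym ρ) bwd (λ v e → proj₁ (inc v e))
  where
  bwd : PreservesInc H (from σ) (from ρ)
  bwd v e i = proj₂ (inc (from σ v) (from ρ e))
                (subst₂ (Inc H) (sym (strictlyInverseˡ σ v)) (sym (strictlyInverseˡ ρ e)) i)

hypAut-preserves : ∀ {H} (h : HypAut H) → PreservesInc H (vmap h) (emap h)
hypAut-preserves (σ , ρ , inc) v e = proj₁ (inc v e)

module _ {m : ℕ} {n : Fin m → ℕ} where

  SamePart : V m n → V m n → Set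
  SamePart u w = proj₁ u ≡ proj₁ w

  -- Equality of parts is decidable, so "non-adjacent" is exactly "same part".
  ¬Adj⇒SamePart : (u w : V m n) → ¬ Adj u w → SamePart u w
  ¬Adj⇒SamePart u w = decidable-stable (proj₁ u ≟ proj₁ w)

  aut-preserves-part : (γ : V m n ↔ V m n) → IsGraphAut γ →
                       ∀ u w → SamePart u w → SamePart (to γ u) (to γ w)
  aut-preserves-part γ g u w same = ¬Adj⇒SamePart (to γ u) (to γ w) (λ adj → proj₂ (g u w) adj same)

  aut-reflects-part : (γ : V m n ↔ V m n) → IsGraphAut γ →
                      ∀ u w → SamePart (to γ u) (to γ w) → SamePart u w
  aut-reflects-part γ g u w same = ¬Adj⇒SamePart u w (λ adj → proj₁ (g u w) adj same)

  part-preserving⇒aut : (γ : V m n ↔ V m n) →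
                        (∀ u w → SamePart u w → SamePart (to γ u) (to γ w)) →
                        (∀ u w → SamePart (to γ u) (to γ w) → SamePart u w) → IsGraphAut γ
  part-preserving⇒aut γ pres refl′ u w =
    (λ adj same → adj (refl′ u w same)) , (λ adj same → adj (pres u w same))

  graphAut⁻¹ : (γ : V m n ↔ V m n) → IsGraphAut γ → IsGraphAut (↔-sym γ)
  graphAut⁻¹ γ g = part-preserving⇒aut (↔-sym γ) pres refl′
    where
    cancel : ∀ u w → SamePart (to γ (from γ u)) (to γ (from γ w)) ≡ SamePart u w
    cancel u w = cong₂ SamePart (strictlyInverseˡ γ u) (strictlyInverseˡ γ w)
    pres : ∀ u w → SamePart u w → SamePart (from γ u) (from γ w)
    pres u w same = aut-reflects-part γ g (from γ u) (from γ w)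
                      (subst id (sym (cancel u w)) same)
    refl′ : ∀ u w → SamePart (from γ u) (from γ w) → SamePart u w
    refl′ u w same = subst id (cancel u w) (aut-preserves-part γ g (from γ u) (from γ w) same)

  relabelling-isGraphAut : (γ : V m n ↔ V m n) (r : Fin m ↔ Fin m) →
                           (∀ v → proj₁ (to γ v) ≡ to r (proj₁ v)) → IsGraphAut γ
  relabelling-isGraphAut γ r moves = part-preserving⇒aut γ pres refl′
    where
    pres : ∀ u w → SamePart u w → SamePart (to γ u) (to γ w)
    pres u w same = trans (moves u) (trans (cong (to r) same) (sym (moves w)))
    refl′ : ∀ u w → SamePart (to γ u) (to γ w) → SamePart u w
    refl′ u w same = ↔-injective r (trans (sym (moves u)) (trans same (moves w)))

  -- Since every part is nonempty, a graph automorphism γ induces a permutation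
  -- ρ_γ of the parts: ρ_γ i is the part containing γ(X_i).
  module PartPermutation (nonempty : ∀ i → 1 ≤ n i) where

    representative : (i : Fin m) → V m n
    representative i = i , first (nonempty i)
      where
      first : ∀ {k} → 1 ≤ k → Fin k
      first (s≤s _) = zero

    partMap : (V m n ↔ V m n) → Fin m → Fin m
    partMap γ i = proj₁ (to γ (representative i))

    partMap-spec : (γ : V m n ↔ V m n) → IsGraphAut γ →
                   ∀ v → proj₁ (to γ v) ≡ partMap γ (proj₁ v)
    partMap-spec γ g v = aut-preserves-part γ g v (representative (proj₁ v)) refl

    partMap-cancel : (γ : V m n ↔ V m n) → IsGraphAut γ →
                     ∀ i → partMap (↔-sym γ) (partMap γ i) ≡ i
    partMap-cancel γ g i = begin
      partMap (↔-sym γ) (partMap γ i)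
        ≡⟨ sym (partMap-spec (↔-sym γ) (graphAut⁻¹ γ g) (to γ (representative i))) ⟩
      proj₁ (from γ (to γ (representative i)))
        ≡⟨ cong proj₁ (strictlyInverseʳ γ (representative i)) ⟩
      i ∎

    partPerm : (γ : V m n ↔ V m n) → IsGraphAut γ → Fin m ↔ Fin m
    partPerm γ g = mk↔ₛ′ (partMap γ) (partMap (↔-sym γ))
                         (partMap-cancel (↔-sym γ) (graphAut⁻¹ γ g)) (partMap-cancel γ g)

module Regular {m t : ℕ} {n : Fin m → ℕ} {p : V m n → Fin t} (reg : IsRegular p) where

  vertex-unique : ∀ u w → SamePart u w → p u ≡ p w → u ≡ w
  vertex-unique (i , a) (.i , b) refl same-block =
    cong (i ,_) (reg i (p (i , b)) a b same-block refl)

  incident : ∀ {j i} v → proj₁ v ≡ i → p v ≡ j → Inc (τ n p) j i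
  incident (i , a) refl in-block = a , in-block , λ b b-in-block → reg i _ b a b-in-block in-block

module Correspondence {m t : ℕ} {n : Fin m → ℕ} (p : V m n → Fin t)
                      (nonempty : ∀ i → 1 ≤ n i) (partition : IsPartition p)
                      (reg : IsRegular p) where
  open PartPermutation nonempty
  open Regular reg

  H : Hypergraph
  H = τ n p

  graphAut : (α : AutP n p) → IsGraphAut (proj₁ α)
  graphAut α = proj₁ (proj₂ α)

  blockPerm : AutP n p → Fin t ↔ Fin t
  blockPerm α = proj₁ (proj₂ (proj₂ α))

  blockPerm-spec : ∀ α v → p (perm α v) ≡ to (blockPerm α) (p v)
  blockPerm-spec α = proj₂ (proj₂ (proj₂ α))

  partPermOf : AutP n p → Fin m ↔ Fin m
  partPermOf α = partPerm (proj₁ α) (graphAut α)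

  partPermOf-spec : ∀ α v → proj₁ (perm α v) ≡ to (partPermOf α) (proj₁ v)
  partPermOf-spec α = partMap-spec (proj₁ α) (graphAut α)

  autP⁻¹ : AutP n p → AutP n p
  autP⁻¹ α = ↔-sym γ , graphAut⁻¹ γ (graphAut α) , ↔-sym π , spec⁻¹
    where
    γ = proj₁ α
    π = blockPerm α
    spec⁻¹ : ∀ v → p (from γ v) ≡ from π (p v)
    spec⁻¹ v = begin
      p (from γ v)                      ≡⟨ sym (strictlyInverseʳ π _) ⟩
      from π (to π (p (from γ v)))      ≡⟨ cong (from π) (sym (blockPerm-spec α (from γ v))) ⟩
      from π (p (to γ (from γ v)))      ≡⟨ cong (λ u → from π (p u)) (strictlyInverseˡ γ v) ⟩
      from π (p v)                      ∎

  -- (π_α , ρ_α) maps the incidence (P_j , X_i), witnessed by a vertex (i , a),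
  -- to the incidence witnessed by α(i , a).
  Φ-preserves : ∀ α → PreservesInc H (to (blockPerm α)) (to (partPermOf α))
  Φ-preserves α j i (a , in-block , _) =
    incident (perm α (i , a)) (partPermOf-spec α (i , a))
             (trans (blockPerm-spec α (i , a)) (cong (to (blockPerm α)) in-block))

  Φ : AutP n p → HypAut H
  Φ α = mkHypAut (blockPerm α) (partPermOf α) (Φ-preserves α) (Φ-preserves (autP⁻¹ α))

  -- π_α is determined by α, because every block is nonempty.
  blockPerm-determined : ∀ α (f : Fin t → Fin t) → (∀ v → p (perm α v) ≡ f (p v)) →
                         ∀ j → to (blockPerm α) j ≡ f j
  blockPerm-determined α f spec = surjection-cancel p partition (to (blockPerm α)) f
    (λ v → trans (sym (blockPerm-spec α v)) (spec v))

  Φ-cong : ∀ α β → α ≈P β → Φ α ≈H Φ β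
  Φ-cong α β α≈β =
      blockPerm-determined α (to (blockPerm β))
        (λ v → trans (cong p (α≈β v)) (blockPerm-spec β v))
    , λ i → cong proj₁ (α≈β (representative i))

  Φ-homo : ∀ α β γ → (∀ v → perm γ v ≡ perm α (perm β v)) →
           (∀ j → vmap (Φ γ) j ≡ vmap (Φ α) (vmap (Φ β) j)) ×
           (∀ i → emap (Φ γ) i ≡ emap (Φ α) (emap (Φ β) i))
  Φ-homo α β γ γ≡αβ = blockPerm-determined γ _ blocks , parts
    where
    blocks : ∀ v → p (perm γ v) ≡ to (blockPerm α) (to (blockPerm β) (p v))
    blocks v = begin
      p (perm γ v)                                ≡⟨ cong p (γ≡αβ v) ⟩
      p (perm α (perm β v))                       ≡⟨ blockPerm-spec α (perm β v) ⟩
      to (blockPerm α) (p (perm β v))             ≡⟨ cong (to (blockPerm α)) (blockPerm-spec β v) ⟩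
      to (blockPerm α) (to (blockPerm β) (p v))   ∎
    parts : ∀ i → partMap (proj₁ γ) i ≡ partMap (proj₁ α) (partMap (proj₁ β) i)
    parts i = trans (cong proj₁ (γ≡αβ (representative i)))
                    (partPermOf-spec α (perm β (representative i)))

  -- By regularity, α(v) is determined by its part ρ_α(part v) and block π_α(p v).
  Φ-injective : ∀ α β → Φ α ≈H Φ β → α ≈P β
  Φ-injective α β (same-π , same-ρ) v = vertex-unique (perm α v) (perm β v)
    (trans (partPermOf-spec α v) (trans (same-ρ (proj₁ v)) (sym (partPermOf-spec β v))))
    (trans (blockPerm-spec α v) (trans (same-π (p v)) (sym (blockPerm-spec β v))))

  -- Lift of an incidence-preserving pair (s , r): (i , a) goes to the vertex of
  -- X_{r i} in the block s(p(i , a)), which exists since (s , r) preserves the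
  -- incidence of p(i , a) with X_i.
  lift : ∀ {s r} → PreservesInc H s r → V m n → V m n
  lift {r = r} pres (i , a) = r i , proj₁ (pres (p (i , a)) i (incident (i , a) refl refl))

  lift-block : ∀ {s r} (pres : PreservesInc H s r) v → p (lift pres v) ≡ s (p v)
  lift-block pres (i , a) = proj₁ (proj₂ (pres (p (i , a)) i (incident (i , a) refl refl)))

  lift-cancel : ∀ {s r s′ r′} (pres : PreservesInc H s r) (pres′ : PreservesInc H s′ r′) →
                (∀ j → s (s′ j) ≡ j) → (∀ i → r (r′ i) ≡ i) →
                ∀ v → lift pres (lift pres′ v) ≡ v
  lift-cancel {s} {s′ = s′} pres pres′ ss′ rr′ v =
    vertex-unique (lift pres (lift pres′ v)) v (rr′ (proj₁ v)) (begin
      p (lift pres (lift pres′ v))   ≡⟨ lift-block pres (lift pres′ v) ⟩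
      s (p (lift pres′ v))           ≡⟨ cong s (lift-block pres′ v) ⟩
      s (s′ (p v))                   ≡⟨ ss′ (p v) ⟩
      p v                            ∎)

  liftAut : HypAut H → AutP n p
  liftAut h = γ , relabelling-isGraphAut γ ρ (λ _ → refl) , σ , lift-block fwd
    where
    σ = proj₁ h
    ρ = proj₁ (proj₂ h)
    fwd = hypAut-preserves h
    bwd = hypAut-preserves (hypAut⁻¹ h)
    γ : V m n ↔ V m n
    γ = mk↔ₛ′ (lift fwd) (lift bwd)
              (lift-cancel fwd bwd (strictlyInverseˡ σ) (strictlyInverseˡ ρ))
              (lift-cancel bwd fwd (strictlyInverseʳ σ) (strictlyInverseʳ ρ))

  Φ-surjective : ∀ h → ∃ λ α → Φ α ≈H h
  Φ-surjective h = liftAut h , (λ _ → refl) , (λ _ → refl)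

lemma3p1 : (m : ℕ) (n : Fin m → ℕ) → (∀ (i : Fin m) → 1 ≤ n i) →
           (t : ℕ) (p : V m n → Fin t) → IsPartition p → IsRegular p →
           Σ (AutP n p → HypAut (τ n p)) (IsGroupIso p)
lemma3p1 m n nonempty t p partition reg = Φ , record
  { cong       = Φ-cong
  ; homo       = Φ-homo
  ; injective  = Φ-injective
  ; surjective = Φ-surjective
  }
  where open Correspondence p nonempty partition reg
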